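{- Let $X$ and $Y$ be disjoint posets and let $R\subseteq X\times Y$. Define the relation $\preceq_0$ on $X\cup Y$ by $\preceq_0\;=\;{\leq_X}\cup{\leq_Y}\cup R$. The following are equivalent: (1) $(X,Y,R)$ is 0-coherent; (2) $\preceq_0$ is a 0-preorder for $(X,Y,R)$; (3) there exists a 0-preorder for $(X,Y,R)$. Moreover, the set of 0-preorders for $(X,Y,R)$ is closed under non-empty intersections and, if it is non-empty, has $\preceq_0$ as its smallest member.
   Context: A 0-preorder for $(X,Y,R)$ is a preorder (reflexive, transitive relation) $\preceq$ on $X\cup Y$ such that: (P1) for all $x\in X$, $y\in Y$: $x\preceq y\iff x\mathrel{R}y$; (P2) for all $x_1,x_2\in X$: $x_1\leq_X x_2\Rightarrow x_1\preceq x_2$; (P3) for all $y_1,y_2\in Y$: $y_1\leq_Y y_2\Rightarrow y_1\preceq y_2$. $(X,Y,R)$ is 0-coherent if (C1) for all $x_1,x_2\in X$ and $y\in Y$, if $x_1\leq_X x_2$ and $x_2\mathrel{R}y$ then $x_1\mathrel{R}y$; and (C2) for all $y_1,y_2\in Y$ and $x\in X$, if $y_1\leq_Y y_2$ and $x\mathrel{R}y_1$ then $x\mathrel{R}y_2$. -}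

module Defs where

open import Level using (Level; _⊔_; Lift)
open import Data.Empty using (⊥)
open import Data.Sum using (_⊎_; inj₁; inj₂)
open import Data.Product using (_×_)
open import Function.Bundles using (_⇔_)
open import Relation.Binary.Core using (Rel; REL)
open import Relation.Binary.Bundles using (Poset)

module ZeroPreorders {c ℓ₁ ℓ₂ : Level}
                     (X Y : Poset c ℓ₁ ℓ₂)
                     (R : REL (Poset.Carrier X) (Poset.Carrier Y) ℓ₂) where

  open Poset X using () renaming (Carrier to |X|; _≤_ to _≤X_)
  open Poset Y using () renaming (Carrier to |Y|; _≤_ to _≤Y_)

  U : Set c
  U = |X| ⊎ |Y|

  record IsPreorderRel {ℓ : Level} (_≼_ : Rel U ℓ) : Set (c ⊔ ℓ) where
    field
      refl  : ∀ a → a ≼ a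
      trans : ∀ {a b d} → a ≼ b → b ≼ d → a ≼ d

  record Is0Preorder {ℓ : Level} (_≼_ : Rel U ℓ) : Set (c ⊔ ℓ ⊔ ℓ₂) where
    field
      preorder : IsPreorderRel _≼_
      P1 : ∀ (x : |X|) (y : |Y|) → (inj₁ x ≼ inj₂ y) ⇔ R x y
      P2 : ∀ {x₁ x₂ : |X|} → x₁ ≤X x₂ → inj₁ x₁ ≼ inj₁ x₂
      P3 : ∀ {y₁ y₂ : |Y|} → y₁ ≤Y y₂ → inj₂ y₁ ≼ inj₂ y₂

  Is0Coherent : Set (c ⊔ ℓ₂)
  Is0Coherent =
    (∀ {x₁ x₂ : |X|} {y : |Y|} → x₁ ≤X x₂ → R x₂ y → R x₁ y) ×
    (∀ {y₁ y₂ : |Y|} {x : |X|} → y₁ ≤Y y₂ → R x y₁ → R x y₂)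

  _≼₀_ : Rel U ℓ₂
  inj₁ a ≼₀ inj₁ b = a ≤X b
  inj₂ a ≼₀ inj₂ b = a ≤Y b
  inj₁ x ≼₀ inj₂ y = R x y
  inj₂ _ ≼₀ inj₁ _ = Lift ℓ₂ ⊥

  _⊆_ : ∀ {ℓ ℓ'} → Rel U ℓ → Rel U ℓ' → Set (c ⊔ ℓ ⊔ ℓ')
  P ⊆ Q = ∀ {a b} → P a b → Q a b

-- ≼₀ is reflexive and contains ≤X, ≤Y and R, so it is a 0-preorder exactly when it is
-- transitive. Composable pairs X–X–Y and X–Y–Y are precisely the situations of C1 and C2,
-- the remaining ones are transitivity of ≤X or ≤Y, and nothing leads from Y back to X.
-- Conversely P1–P3 force every 0-preorder to contain ≼₀, and its transitivity read through
-- P1 yields C1 and C2; so the existence of any 0-preorder already gives coherence.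
module Submission where

open import Defs
open import Level using (Level; lift)
open import Data.Product using (_×_; Σ; _,_)
open import Data.Sum using (inj₁; inj₂)
open import Function.Bundles using (_⇔_; mk⇔; Equivalence)
open import Relation.Binary.Core using (Rel; REL)
open import Relation.Binary.Bundles using (Poset)

module ZeroPreorderProperties {c ℓ₁ ℓ₂ : Level} (X Y : Poset c ℓ₁ ℓ₂)
    (R : REL (Poset.Carrier X) (Poset.Carrier Y) ℓ₂) where

  open ZeroPreorders X Y R
  open Equivalence using (to; from)
  module X = Poset X
  module Y = Poset Y

  ≼₀-refl : ∀ a → a ≼₀ a
  ≼₀-refl (inj₁ x) = X.refl
  ≼₀-refl (inj₂ y) = Y.refl

  ≼₀-trans : Is0Coherent → ∀ {a b d} → a ≼₀ b → b ≼₀ d → a ≼₀ d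
  ≼₀-trans _         {inj₁ _} {inj₁ _} {inj₁ _} p q        = X.trans p q
  ≼₀-trans (C1 , _)  {inj₁ _} {inj₁ _} {inj₂ _} p q        = C1 p q
  ≼₀-trans (_ , C2)  {inj₁ _} {inj₂ _} {inj₂ _} p q        = C2 q p
  ≼₀-trans _         {inj₂ _} {inj₂ _} {inj₂ _} p q        = Y.trans p q
  ≼₀-trans _         {inj₁ _} {inj₂ _} {inj₁ _} _ (lift ())
  ≼₀-trans _         {inj₂ _} {inj₁ _}          (lift ()) _
  ≼₀-trans _         {inj₂ _} {inj₂ _} {inj₁ _} _ (lift ())

  is0Coherent⇒≼₀-is0Preorder : Is0Coherent → Is0Preorder _≼₀_
  is0Coherent⇒≼₀-is0Preorder coh = record
    { preorder = record { refl = ≼₀-refl ; trans = λ {a b d} → ≼₀-trans coh {a} {b} {d} }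
    ; P1       = λ _ _ → mk⇔ (λ r → r) (λ r → r)
    ; P2       = λ le → le
    ; P3       = λ le → le
    }

  is0Preorder⇒is0Coherent : ∀ {ℓ} {_≼_ : Rel U ℓ} → Is0Preorder _≼_ → Is0Coherent
  is0Preorder⇒is0Coherent pre = C1 , C2
    where
    open Is0Preorder pre
    open IsPreorderRel preorder using (trans)

    C1 : ∀ {x₁ x₂ y} → x₁ X.≤ x₂ → R x₂ y → R x₁ y
    C1 {x₁} {x₂} {y} le r = to (P1 x₁ y) (trans (P2 le) (from (P1 x₂ y) r))

    C2 : ∀ {y₁ y₂ x} → y₁ Y.≤ y₂ → R x y₁ → R x y₂
    C2 {y₁} {y₂} {x} le r = to (P1 x y₂) (trans (from (P1 x y₁) r) (P3 le))

  ≼₀⊆is0Preorder : ∀ {ℓ} {_≼_ : Rel U ℓ} → Is0Preorder _≼_ → _≼₀_ ⊆ _≼_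
  ≼₀⊆is0Preorder pre {inj₁ x} {inj₁ _} le        = Is0Preorder.P2 pre le
  ≼₀⊆is0Preorder pre {inj₁ x} {inj₂ y} r         = from (Is0Preorder.P1 pre x y) r
  ≼₀⊆is0Preorder pre {inj₂ _} {inj₂ _} le        = Is0Preorder.P3 pre le
  ≼₀⊆is0Preorder pre {inj₂ _} {inj₁ _} (lift ())

  -- The index i₀ is needed only for the forward direction of P1: an empty intersection
  -- relates every x to every y.
  ⋂-is0Preorder : ∀ {ι ℓ} (I : Set ι) → I → (P : I → Rel U ℓ) →
                  (∀ i → Is0Preorder (P i)) → Is0Preorder (λ a b → ∀ i → P i a b)
  ⋂-is0Preorder I i₀ P pre = record
    { preorder = record
      { refl  = λ a i → IsPreorderRel.refl (Is0Preorder.preorder (pre i)) a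
      ; trans = λ p q i → IsPreorderRel.trans (Is0Preorder.preorder (pre i)) (p i) (q i)
      }
    ; P1 = λ x y → mk⇔ (λ p → to (Is0Preorder.P1 (pre i₀) x y) (p i₀))
                       (λ r i → from (Is0Preorder.P1 (pre i) x y) r)
    ; P2 = λ le i → Is0Preorder.P2 (pre i) le
    ; P3 = λ le i → Is0Preorder.P3 (pre i) le
    }

theorem3p4 : ∀ {c ℓ₁ ℓ₂ ι ℓ : Level} (X Y : Poset c ℓ₁ ℓ₂)
    (R : REL (Poset.Carrier X) (Poset.Carrier Y) ℓ₂) →
    let open ZeroPreorders X Y R in
    -- (1) ⇔ (2)
    (Is0Coherent ⇔ Is0Preorder _≼₀_)
    -- (2) ⇔ (3)
    × (Is0Preorder _≼₀_ ⇔ Σ (Rel U ℓ₂) (λ P → Is0Preorder P))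
    -- closure under non-empty intersections
    × ((I : Set ι) → I → (P : I → Rel U ℓ) →
         (∀ i → Is0Preorder (P i)) →
         Is0Preorder (λ a b → ∀ i → P i a b))
    -- if non-empty, ≼₀ is the smallest 0-preorder
    × (Σ (Rel U ℓ₂) (λ P → Is0Preorder P) →
         Is0Preorder _≼₀_ × ((P : Rel U ℓ) → Is0Preorder P → _≼₀_ ⊆ P))
theorem3p4 X Y R =
    mk⇔ is0Coherent⇒≼₀-is0Preorder is0Preorder⇒is0Coherent
  , mk⇔ (λ pre → _≼₀_ , pre) ≼₀-is0Preorder-of-any
  , ⋂-is0Preorder
  , λ some → ≼₀-is0Preorder-of-any some , λ _ pre → ≼₀⊆is0Preorder pre
  where
  open ZeroPreorders X Y R
  open ZeroPreorderProperties X Y R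

  ≼₀-is0Preorder-of-any : Σ (Rel U _) Is0Preorder → Is0Preorder _≼₀_
  ≼₀-is0Preorder-of-any (_ , pre) = is0Coherent⇒≼₀-is0Preorder (is0Preorder⇒is0Coherent pre)
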